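{- Let $p:\mathbb E\to\mathbb B$ be a posetal fibration with fibred small limits and $\mathcal T$ a monad on $\mathbb B$. For any lifting $\dot{\mathcal T}$ of $\mathcal T$ along $p$, $\dot T=\bigwedge_{X\in\mathbb E}[q_X(\dot T)]^{pX}$.
   Context: $p$ posetal: fibres are posets; $p$ faithful and $\mathbb E(X,Y)\subseteq\mathbb B(pX,pY)$. Fibres have arbitrary meets. $\mathcal T=(T,\eta,\mu)$, $f^\#=\mu\circ Tf$. $\mathbf{Lift}(\mathcal T)$ is the class of liftings of $\mathcal T$ along $p$ (monads on $\mathbb E$ with $p\dot T=Tp$, $p\dot\eta=\eta p$, $p\dot\mu=\mu p$), ordered by $\dot T\preceq\dot T'$ iff $\dot TY\le\dot T'Y$ for all $Y$; it has arbitrary (class-size) meets computed pointwise: $(\bigwedge_i\dot T_i)Y=\bigwedge_i\dot T_iY$. For $R\in\mathbb B$, $S\in\mathbb E_{TR}$, $[S]^R$ is the (pointwise) codensity lifting with single parameter $(R,S)$, a lifting with $[S]^RY=\bigwedge_{f\in\mathbb E(Y,S)}(f^\#)^{ -1}(S)$. $q_X(\dot T)=\dot TX$. -}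

module Defs where

open import Level using (Level; suc; _⊔_)
open import Data.Product using (Σ; _,_; proj₁; proj₂; Σ-syntax)
open import Relation.Binary.PropositionalEquality using (_≡_)
open import Relation.Binary.Bundles using (Poset)

record Category (ℓ : Level) : Set (suc ℓ) where
  infixr 9 _∘_
  field
    Obj  : Set ℓ
    Hom  : Obj → Obj → Set ℓ
    id   : ∀ {A} → Hom A A
    _∘_  : ∀ {A B C} → Hom B C → Hom A B → Hom A C
    identityˡ : ∀ {A B} (f : Hom A B) → id ∘ f ≡ f
    identityʳ : ∀ {A B} (f : Hom A B) → f ∘ id ≡ f
    assoc : ∀ {A B C D} (h : Hom C D) (g : Hom B C) (f : Hom A B) →
            (h ∘ g) ∘ f ≡ h ∘ (g ∘ f)

record Monad {ℓ : Level} (𝔹 : Category ℓ) : Set ℓ where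
  open Category 𝔹
  field
    T₀ : Obj → Obj
    T₁ : ∀ {A B} → Hom A B → Hom (T₀ A) (T₀ B)
    T-id : ∀ {A} → T₁ (id {A}) ≡ id
    T-∘  : ∀ {A B C} (g : Hom B C) (f : Hom A B) → T₁ (g ∘ f) ≡ T₁ g ∘ T₁ f
    η : ∀ A → Hom A (T₀ A)
    μ : ∀ A → Hom (T₀ (T₀ A)) (T₀ A)
    η-natural : ∀ {A B} (f : Hom A B) → T₁ f ∘ η A ≡ η B ∘ f
    μ-natural : ∀ {A B} (f : Hom A B) → T₁ f ∘ μ A ≡ μ B ∘ T₁ (T₁ f)
    unitˡ : ∀ A → μ A ∘ η (T₀ A) ≡ id
    unitʳ : ∀ A → μ A ∘ T₁ (η A) ≡ id
    mult  : ∀ A → μ A ∘ T₁ (μ A) ≡ μ A ∘ μ (T₀ A)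

  _♯ : ∀ {A B} → Hom A (T₀ B) → Hom (T₀ A) (T₀ B)
  f ♯ = μ _ ∘ T₁ f

-- A posetal fibration p : 𝔼 → 𝔹 with fibred small limits, presented (as usual
-- for posetal fibrations) by its fibres 𝔼_I (posets) and reindexing maps f^*.
-- Objects of 𝔼 are pairs (I , P) with P ∈ 𝔼_I, p(I , P) = I, and
-- 𝔼((I,P),(J,Q)) = { f ∈ 𝔹(I,J) | P ≤ f^* Q } ⊆ 𝔹(I,J).
-- Fibres have arbitrary meets (over any index type in Set ℓ, which includes
-- the class of all objects of 𝔼 and all hom-sets) preserved by reindexing.
record PosetalFibration {ℓ : Level} (𝔹 : Category ℓ) : Set (suc ℓ) where
  open Category 𝔹
  field
    fibre : Obj → Poset ℓ ℓ ℓ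
  module Fib (I : Obj) = Poset (fibre I)
  open Fib public using () renaming (Carrier to E)
  Le : ∀ I → E I → E I → Set ℓ
  Le I = Fib._≤_ I
  syntax Le I P Q = P ≤[ I ] Q
  Eq : ∀ I → E I → E I → Set ℓ
  Eq I = Fib._≈_ I
  syntax Eq I P Q = P ≈[ I ] Q
  field
    _^* : ∀ {I J} → Hom I J → E J → E I
    ^*-mono : ∀ {I J} (f : Hom I J) {P Q : E J} → P ≤[ J ] Q → (f ^*) P ≤[ I ] (f ^*) Q
    ^*-id   : ∀ {I} (P : E I) → (id ^*) P ≈[ I ] P
    ^*-∘    : ∀ {I J K} (g : Hom J K) (f : Hom I J) (P : E K) →
              ((g ∘ f) ^*) P ≈[ I ] (f ^*) ((g ^*) P)
    ⋀ : ∀ {I} {A : Set ℓ} → (A → E I) → E I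
    ⋀-lb : ∀ {I} {A : Set ℓ} (P : A → E I) (a : A) → ⋀ P ≤[ I ] P a
    ⋀-glb : ∀ {I} {A : Set ℓ} (P : A → E I) (Q : E I) →
            (∀ a → Q ≤[ I ] P a) → Q ≤[ I ] ⋀ P
    ^*-⋀ : ∀ {I J} (f : Hom I J) {A : Set ℓ} (P : A → E J) →
           (f ^*) (⋀ P) ≈[ I ] ⋀ (λ a → (f ^*) (P a))

-- A lifting of 𝒯 along p: a monad (Ṫ, η̇, μ̇) on 𝔼 with pṪ = Tp, pη̇ = ηp,
-- pμ̇ = μp.  Since p is faithful and posetal, this amounts to an object map
-- Ṫ : 𝔼_I → 𝔼_{TI} such that T f, η_I, μ_I are morphisms of 𝔼 between the
-- appropriate objects (all equations then hold automatically, as p is faithful).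
record Lifting {ℓ : Level} {𝔹 : Category ℓ} (p : PosetalFibration 𝔹) (𝒯 : Monad 𝔹)
       : Set ℓ where
  open Category 𝔹
  open Monad 𝒯
  open PosetalFibration p
  field
    Ṫ : ∀ {I} → E I → E (T₀ I)
    Ṫ-map : ∀ {I J} (f : Hom I J) {P : E I} {Q : E J} →
            P ≤[ I ] (f ^*) Q → Ṫ P ≤[ T₀ I ] (T₁ f ^*) (Ṫ Q)
    η̇ : ∀ {I} (P : E I) → P ≤[ I ] (η I ^*) (Ṫ P)
    μ̇ : ∀ {I} (P : E I) → Ṫ (Ṫ P) ≤[ T₀ (T₀ I) ] (μ I ^*) (Ṫ P)

module _ {ℓ : Level} {𝔹 : Category ℓ} (p : PosetalFibration 𝔹) (𝒯 : Monad 𝔹) where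
  open Category 𝔹
  open Monad 𝒯
  open PosetalFibration p

  Ob𝔼 : Set ℓ
  Ob𝔼 = Σ Obj E

  -- Codensity lifting with single parameter (R , S), S ∈ 𝔼_{TR}, on objects:
  -- [S]^R (I , P) = ⋀_{f ∈ 𝔼((I,P),(TR,S))} (f^#)^* S   ∈ 𝔼_{TI}
  codensity : (R : Obj) (S : E (T₀ R)) → ∀ {I} → E I → E (T₀ I)
  codensity R S {I} P = ⋀ {A = Σ[ f ∈ Hom I (T₀ R) ] (P ≤[ I ] (f ^*) S)}
                          (λ fh → ((proj₁ fh ♯) ^*) S)

  q : (X : Ob𝔼) → Lifting p 𝒯 → E (T₀ (proj₁ X))
  q X L = Lifting.Ṫ L (proj₂ X)

  codensityMeet : Lifting p 𝒯 → ∀ {I} → E I → E (T₀ I)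
  codensityMeet L P = ⋀ {A = Ob𝔼} (λ X → codensity (proj₁ X) (q X L) P)

-- Ṫ lies below every [Ṫ Q]^R, since μ̇ makes each Ṫ Q closed under Ṫ; conversely the
-- component X = P of the meet is already below Ṫ P, witnessed by the map η̇ : P → Ṫ P,
-- whose Kleisli extension μ ∘ T η is the identity.
module Submission where

open import Defs
open import Level using (Level)
open import Data.Product using (_,_)
open import Relation.Binary.PropositionalEquality using (_≡_; subst; sym)
import Relation.Binary.Reasoning.PartialOrder as PosetReasoning

module CodensityLifting {ℓ : Level} {𝔹 : Category ℓ}
                        (p : PosetalFibration 𝔹) (𝒯 : Monad 𝔹) where
  open Category 𝔹
  open Monad 𝒯
  open PosetalFibration p

  ^*-≡ : ∀ {I J} {f g : Hom I J} (S : E J) → f ≡ g → (g ^*) S ≤[ I ] (f ^*) S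
  ^*-≡ {I} S f≡g = subst (λ h → _ ≤[ I ] (h ^*) S) (sym f≡g) (Fib.refl I)

  codensity-≤-at-unit : ∀ {I} {P : E I} {S : E (T₀ I)} →
                        P ≤[ I ] (η I ^*) S → codensity p 𝒯 I S P ≤[ T₀ I ] S
  codensity-≤-at-unit {I} {P} {S} P≤η*S = begin
    codensity p 𝒯 I S P  ≤⟨ ⋀-lb _ (η I , P≤η*S) ⟩
    ((η I ♯) ^*) S       ≤⟨ ^*-≡ S (sym (unitʳ I)) ⟩
    (id ^*) S            ≈⟨ ^*-id S ⟩
    S                    ∎
    where open PosetReasoning (fibre (T₀ I))

  module _ (L : Lifting p 𝒯) where
    open Lifting L

    Ṫ-≤-codensity : ∀ {R} {S : E (T₀ R)} → Ṫ S ≤[ T₀ (T₀ R) ] (μ R ^*) S →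
                    ∀ {I} (P : E I) → Ṫ P ≤[ T₀ I ] codensity p 𝒯 R S P
    Ṫ-≤-codensity {R} {S} ṪS≤μ*S {I} P = ⋀-glb _ _ λ (f , P≤f*S) → begin
      Ṫ P                       ≤⟨ Ṫ-map f P≤f*S ⟩
      (T₁ f ^*) (Ṫ S)           ≤⟨ ^*-mono (T₁ f) ṪS≤μ*S ⟩
      (T₁ f ^*) ((μ R ^*) S)    ≈⟨ Fib.Eq.sym (T₀ I) (^*-∘ (μ R) (T₁ f) S) ⟩
      ((f ♯) ^*) S              ∎
      where open PosetReasoning (fibre (T₀ I))

open CodensityLifting

theorem8p6 : ∀ {ℓ : Level} (𝔹 : Category ℓ) (p : PosetalFibration 𝔹) (𝒯 : Monad 𝔹)
               (L : Lifting p 𝒯) →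
               ∀ (I : Category.Obj 𝔹) (P : PosetalFibration.E p I) →
               PosetalFibration.Eq p (Monad.T₀ 𝒯 I) (Lifting.Ṫ L P) (codensityMeet p 𝒯 L P)
theorem8p6 𝔹 p 𝒯 L I P = Fib.antisym (T₀ I)
  (⋀-glb _ _ λ (_ , Q) → Ṫ-≤-codensity p 𝒯 L (μ̇ Q) P)
  (Fib.trans (T₀ I) (⋀-lb _ (I , P)) (codensity-≤-at-unit p 𝒯 (η̇ P)))
  where
  open Monad 𝒯
  open PosetalFibration p
  open Lifting L
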